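{- Let $d/2,k,r,s,t$ be integers with $2 \le d/2 \le k$, $0 \le r$, $k \le s+t$, and $0 \le t \le \min\{k-d/2,r\}$. Let $\mathcal{B}$ be an $(s+t,\#\mathcal{B},d;k)_q$ CDC, $\mathcal{R}$ be a $(k \times (r-t),\#\mathcal{R},d/2;k-d/2-t)_q$ RMC, and let $W$ be the subspace of dimension $s$ in $\mathbb{F}_q^{r+s}$ spanned by the rows of the matrix $(0 \mid I)$ (an $s \times r$ zero block followed by the $s \times s$ identity). Then $\dim(W \cap \tau^{ -1}(R \mid \tau(B)) ) \ge d/2$ for all $R \in \mathcal{R}$ and $B \in \mathcal{B}$. In particular, \begin{align*} B_q(r+s,s,d;k) \ge A_q(s+t,d;k) \cdot \Lambda(q,k,r-t,d/2,k-d/2-t). \end{align*}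
   Context: Notation: $\mathbb{F}_q$ is the finite field with $q$ elements. For a $k$-subspace $U$ of $\mathbb{F}_q^v$, $\tau(U)\in\mathbb{F}_q^{k\times v}$ is the unique matrix in reduced row echelon form whose row span is $U$; for a matrix $A$ of full row rank, $\tau^{ -1}(A)$ denotes the row span of $A$. $(A \mid B)$ denotes horizontal concatenation of matrices. The subspace distance is $d_S(U,W)=\dim U+\dim W-2\dim(U\cap W)$. A $(v,N,d;k)_q$ constant-dimension code (CDC) is a set of $N$ $k$-subspaces of $\mathbb{F}_q^v$ with pairwise subspace distance at least $d$; $A_q(v,d;k)$ is the maximum $N$ of such a code. An $(a\times b,N,d)_q$ rank-metric code (RMC) is a subset of $\mathbb{F}_q^{a\times b}$ of cardinality $N$ with pairwise rank distance $\operatorname{rk}(A-B)\ge d$; an $(a\times b,N,d;u)_q$ RMC additionally has every codeword of rank at most $u$, and $\Lambda(q,a,b,d,u)$ is the maximum size of such a code. Matrices with zero rows or columns are allowed, and a set containing only one such matrix has cardinality one. For $0\le w\le v$, $B_q(v,w,d;k)$ is the maximum cardinality of a $(v,N,d;k)_q$ CDC $\mathcal{B}$ such that there is a $w$-subspace $W$ with $\dim(W\cap B)\ge d/2$ for each $B\in\mathcal{B}$. -}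

module Defs where

open import Level using (0ℓ)
open import Data.Nat using (ℕ; zero; suc; _+_; _*_; _∸_; _≤_; _<_)
open import Data.Nat.Properties using (m∸n+n≡m; +-comm; +-assoc)
open import Data.Fin using (Fin; splitAt) renaming (_<_ to _<ᶠ_)
import Data.Fin as Fin
open import Data.Sum using (inj₁; inj₂)
open import Data.Product using (Σ; ∃; ∃-syntax; _×_; _,_)
open import Relation.Binary.PropositionalEquality using (_≡_; _≢_; refl; sym; trans; cong)
open import Relation.Nullary using (¬_; yes; no)
open import Algebra.Structures using (IsCommutativeRing)
open import Function.Bundles using (_↔_)

record FiniteField (q : ℕ) : Set₁ where
  infixl 6 _+F_
  infixl 7 _*F_
  field
    Carrier : Set
    _+F_ _*F_ : Carrier → Carrier → Carrier
    -F_ : Carrier → Carrier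
    0F 1F : Carrier
    isCommutativeRing : IsCommutativeRing _≡_ _+F_ _*F_ -F_ 0F 1F
    0≢1 : 0F ≢ 1F
    inverse : ∀ x → x ≢ 0F → Σ Carrier (λ y → x *F y ≡ 1F)
    enumeration : Fin q ↔ Carrier

module LinAlg {q : ℕ} (F : FiniteField q) where
  open FiniteField F

  Vect : ℕ → Set
  Vect n = Fin n → Carrier

  Mat : ℕ → ℕ → Set
  Mat a b = Fin a → Fin b → Carrier

  ΣF : ∀ {m} → (Fin m → Carrier) → Carrier
  ΣF {zero}  f = 0F
  ΣF {suc m} f = f Fin.zero +F ΣF (λ i → f (Fin.suc i))

  lincomb : ∀ {m n} → (Fin m → Carrier) → (Fin m → Vect n) → Vect n
  lincomb c vs j = ΣF (λ i → c i *F vs i j)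

  LinIndep : ∀ {m n} → (Fin m → Vect n) → Set
  LinIndep {m} vs = (c : Fin m → Carrier) →
    (∀ j → lincomb c vs j ≡ 0F) → ∀ i → c i ≡ 0F

  InRowSpan : ∀ {a n} → Mat a n → Vect n → Set
  InRowSpan A x = Σ (Fin _ → Carrier) (λ c → ∀ j → x j ≡ lincomb c A j)

  SameRowSpan : ∀ {a b n} → Mat a n → Mat b n → Set
  SameRowSpan A B = ∀ x → (InRowSpan A x → InRowSpan B x) × (InRowSpan B x → InRowSpan A x)

  _∩_ : ∀ {n} → (Vect n → Set) → (Vect n → Set) → Vect n → Set
  (U ∩ W) x = U x × W x

  DimAtLeast : ∀ {n} → (Vect n → Set) → ℕ → Set
  DimAtLeast {n} U m = Σ (Fin m → Vect n) (λ vs → LinIndep vs × (∀ i → U (vs i)))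

  HasDim : ∀ {n} → (Vect n → Set) → ℕ → Set
  HasDim U m = DimAtLeast U m × ¬ DimAtLeast U (suc m)

  RankAtLeast : ∀ {a b} → Mat a b → ℕ → Set
  RankAtLeast A m = DimAtLeast (InRowSpan A) m

  RankAtMost : ∀ {a b} → Mat a b → ℕ → Set
  RankAtMost A u = ¬ DimAtLeast (InRowSpan A) (suc u)

  FullRowRank : ∀ {a b} → Mat a b → Set
  FullRowRank A = LinIndep A

  -- subspace distance d_S(U,W) = dim U + dim W - 2 dim (U ∩ W) ≥ d
  SubspaceDistAtLeast : ∀ {n} → (Vect n → Set) → (Vect n → Set) → ℕ → Set
  SubspaceDistAtLeast U W d = ∀ a b c → HasDim U a → HasDim W b → HasDim (U ∩ W) c →
    d + 2 * c ≤ a + b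

  _-M_ : ∀ {a b} → Mat a b → Mat a b → Mat a b
  (A -M B) i j = A i j +F (-F B i j)

  _≡M_ : ∀ {a b} → Mat a b → Mat a b → Set
  A ≡M B = ∀ i j → A i j ≡ B i j

  IsRREF : ∀ {k n} → Mat k n → Set
  IsRREF {k} {n} T = Σ (Fin k → Fin n) λ piv →
      (∀ i i' → i <ᶠ i' → piv i <ᶠ piv i')
    × (∀ i → T i (piv i) ≡ 1F)
    × (∀ i j → j <ᶠ piv i → T i j ≡ 0F)
    × (∀ i i' → i' ≢ i → T i' (piv i) ≡ 0F)

  IsCDC : (v N d k : ℕ) → (Fin N → Mat k v) → Set
  IsCDC v N d k 𝓒 =
      (∀ i → FullRowRank (𝓒 i))
    × (∀ i j → i ≢ j → ¬ SameRowSpan (𝓒 i) (𝓒 j))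
    × (∀ i j → i ≢ j → SubspaceDistAtLeast (InRowSpan (𝓒 i)) (InRowSpan (𝓒 j)) d)

  IsRMC : (a b N d u : ℕ) → (Fin N → Mat a b) → Set
  IsRMC a b N d u 𝓡 =
      (∀ i j → i ≢ j → ¬ (𝓡 i ≡M 𝓡 j))
    × (∀ i j → i ≢ j → RankAtLeast (𝓡 i -M 𝓡 j) d)
    × (∀ i → RankAtMost (𝓡 i) u)

  _∣_ : ∀ {k a b} → Mat k a → Mat k b → Mat k (a + b)
  _∣_ {a = a} A B i j with splitAt a j
  ... | inj₁ j₁ = A i j₁
  ... | inj₂ j₂ = B i j₂

  castMat : ∀ {k a b} → a ≡ b → Mat k a → Mat k b
  castMat refl A = A

  ZeroId : (r s : ℕ) → Mat s (r + s)
  ZeroId r s i j with splitAt r j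
  ... | inj₁ _ = 0F
  ... | inj₂ j₂ with i Fin.≟ j₂
  ...   | yes _ = 1F
  ...   | no _  = 0F

colEq : (r s t : ℕ) → t ≤ r → (r ∸ t) + (s + t) ≡ r + s
colEq r s t t≤r =
  trans (cong ((r ∸ t) +_) (+-comm s t))
  (trans (sym (+-assoc (r ∸ t) t s)) (cong (_+ s) (m∸n+n≡m t≤r)))

-- Let W be the row space of (0 | I), i.e. the vectors vanishing on the first r coordinates.
-- If rk R ≤ k − δ − t, the left kernel of R has dimension at least δ + t, and the combinations
-- in it that also annihilate the first t columns of T still form a space of dimension at least δ.
-- For each such γ the vector γ (R | T) vanishes on the first (r − t) + t = r coordinates, so it
-- lies in W. The lifted subspaces τ⁻¹(R | B) form a CDC since they all have dimension k and any
-- two of them meet in dimension at most k − δ: for B ≠ B' the intersection projects injectively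
-- into B ∩ B', and for equal B its coefficient vectors lie in the left kernel of R − R', which
-- has rank at least δ.

module Submission where

open import Defs
open import Data.Nat using (ℕ; zero; suc; _+_; _*_; _∸_; _≤_; _<_; z≤n; s≤s; _≤′_; ≤′-refl; ≤′-step)
open import Data.Product using (Σ; _×_; ∃; _,_; proj₁; proj₂; map₁; uncurry)
open import Level using (0ℓ)
open import Algebra.Bundles using (CommutativeRing)
open import Algebra.Structures using (IsCommutativeRing)
open import Data.Empty using (⊥-elim)
open import Data.Fin as Fin using (Fin; zero; suc; punchIn; _↑ˡ_; _↑ʳ_; splitAt; toℕ)
import Data.Fin.Properties as Fin
import Data.Nat.Properties as ℕ
open import Data.Sum using (_⊎_; inj₁; inj₂)
open import Data.Vec.Functional using ([]; _∷_; head; tail; _++_; insertAt; removeAt)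
open import Data.Vec.Functional.Properties using (lookup-++ˡ; lookup-++ʳ; insertAt-lookup; insertAt-punchIn)
open import Function using (_∘_; const; Inverse)
open import Relation.Binary.Definitions using (DecidableEquality; _Respects_)
open import Relation.Binary.PropositionalEquality
open import Relation.Nullary using (¬_; Dec; yes; no; _×-dec_)
open import Relation.Nullary.Decidable using (map′; decidable-stable; ¬?; ¬¬-excluded-middle)
open import Relation.Unary using (Decidable; _⊆_)

∀-↑ : ∀ {c d} {P : Fin (c + d) → Set} → (∀ i → P (i ↑ˡ d)) → (∀ i → P (c ↑ʳ i)) → ∀ i → P i
∀-↑ {c} {d} {P} left right i = subst P (Fin.join-splitAt c d i) (by-side (splitAt c i))
  where
  by-side : ∀ s → P (Fin.join c d s)
  by-side (inj₁ i) = left i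
  by-side (inj₂ i) = right i

suc-∸-≤ : ∀ m n → suc m ∸ n ≤ suc (m ∸ n)
suc-∸-≤ m n = ℕ.m≤n+o⇒m∸n≤o (suc m) n
  (ℕ.≤-trans (s≤s (ℕ.m≤n+m∸n m n)) (ℕ.≤-reflexive (sym (ℕ.+-suc n (m ∸ n)))))

2*[m+n]≡2*n+2*m : ∀ m n → 2 * (m + n) ≡ 2 * n + 2 * m
2*[m+n]≡2*n+2*m m n = trans (ℕ.*-distribˡ-+ 2 m n) (ℕ.+-comm (2 * m) (2 * n))

2*m≡m+m : ∀ m → 2 * m ≡ m + m
2*m≡m+m m = cong (m +_) (ℕ.+-identityʳ m)

double-≤ : ∀ {m δ k} → m + δ ≤ k → 2 * δ + 2 * m ≤ k + k
double-≤ {m} {δ} {k} le = subst₂ _≤_ (2*[m+n]≡2*n+2*m m δ) (2*m≡m+m k) (ℕ.*-monoʳ-≤ 2 le)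

halve-≤ : ∀ {m δ k} → 2 * δ + 2 * m ≤ k + k → m + δ ≤ k
halve-≤ {m} {δ} {k} le =
  ℕ.*-cancelˡ-≤ 2 (subst₂ _≤_ (sym (2*[m+n]≡2*n+2*m m δ)) (sym (2*m≡m+m k)) le)

m+n+[o∸m∸n]≡o : ∀ {m n o} → m ≤ o → n ≤ o ∸ m → m + n + (o ∸ m ∸ n) ≡ o
m+n+[o∸m∸n]≡o {m} {n} {o} m≤o n≤o∸m = begin
  m + n + (o ∸ m ∸ n)    ≡⟨ ℕ.+-assoc m n _ ⟩
  m + (n + (o ∸ m ∸ n))  ≡⟨ cong (m +_) (ℕ.m+[n∸m]≡n n≤o∸m) ⟩
  m + (o ∸ m)            ≡⟨ ℕ.m+[n∸m]≡n m≤o ⟩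
  o                      ∎
  where open ≡-Reasoning

module FiniteFieldLinearAlgebra {q : ℕ} (F : FiniteField q) where
  open FiniteField F
  open LinAlg F
  open IsCommutativeRing isCommutativeRing
    using (+-assoc; +-identityˡ; +-identityʳ; -‿inverseʳ; *-assoc; *-comm;
           *-identityˡ; distribʳ; zeroˡ; zeroʳ)
  open ≡-Reasoning

  commutativeRing : CommutativeRing 0ℓ 0ℓ
  commutativeRing = record
    { Carrier = Carrier ; _≈_ = _≡_ ; _+_ = _+F_ ; _*_ = _*F_ ; -_ = -F_ ; 0# = 0F ; 1# = 1F
    ; isCommutativeRing = isCommutativeRing }

  open CommutativeRing commutativeRing using (ring; semiring)
  open import Algebra.Properties.Ring ring
    using (-‿distribˡ-*; -1*x≈-x; x∙y⁻¹≈ε⇒x≈y; x[y-z]≈xy-xz; [y-z]x≈yx-zx)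
  open import Algebra.Properties.Semiring.Sum semiring
    using (sum; sum-cong-≗; sum-replicate-zero; sum-remove; ∑-distrib-+; ∑-comm;
           *-distribˡ-sum; *-distribʳ-sum)

  1≢0 : 1F ≢ 0F
  1≢0 = 0≢1 ∘ sym

  x*y≡0⇒y≡0 : ∀ {x y} → x ≢ 0F → x *F y ≡ 0F → y ≡ 0F
  x*y≡0⇒y≡0 {x} {y} x≢0 xy≡0 with inverse x x≢0
  ... | x⁻¹ , xx⁻¹≡1 = begin
    y                 ≡⟨ *-identityˡ y ⟨
    1F *F y           ≡⟨ cong (_*F y) xx⁻¹≡1 ⟨
    (x *F x⁻¹) *F y   ≡⟨ cong (_*F y) (*-comm x x⁻¹) ⟩
    (x⁻¹ *F x) *F y   ≡⟨ *-assoc x⁻¹ x y ⟩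
    x⁻¹ *F (x *F y)   ≡⟨ cong (x⁻¹ *F_) xy≡0 ⟩
    x⁻¹ *F 0F         ≡⟨ zeroʳ x⁻¹ ⟩
    0F                ∎

  ΣF≡sum : ∀ {m} (f : Vect m) → ΣF f ≡ sum f
  ΣF≡sum {zero}  f = refl
  ΣF≡sum {suc m} f = cong (f zero +F_) (ΣF≡sum (f ∘ suc))

  ΣF-cong : ∀ {m} {f g : Vect m} → f ≗ g → ΣF f ≡ ΣF g
  ΣF-cong {f = f} {g} f≗g = trans (ΣF≡sum f) (trans (sum-cong-≗ f≗g) (sym (ΣF≡sum g)))

  ΣF-zero : ∀ {m} {f : Vect m} → (∀ i → f i ≡ 0F) → ΣF f ≡ 0F
  ΣF-zero {m} f≗0 = trans (ΣF-cong f≗0) (trans (ΣF≡sum {m} (const 0F)) (sum-replicate-zero m))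

  ΣF-+ : ∀ {m} (f g : Vect m) → ΣF (λ i → f i +F g i) ≡ ΣF f +F ΣF g
  ΣF-+ f g = begin
    ΣF (λ i → f i +F g i)  ≡⟨ ΣF≡sum (λ i → f i +F g i) ⟩
    sum (λ i → f i +F g i) ≡⟨ ∑-distrib-+ f g ⟩
    sum f +F sum g         ≡⟨ cong₂ _+F_ (ΣF≡sum f) (ΣF≡sum g) ⟨
    ΣF f +F ΣF g           ∎

  ΣF-*ˡ : ∀ {m} x (f : Vect m) → x *F ΣF f ≡ ΣF (λ i → x *F f i)
  ΣF-*ˡ x f =
    trans (cong (x *F_) (ΣF≡sum f)) (trans (*-distribˡ-sum x f) (sym (ΣF≡sum (λ i → x *F f i))))

  ΣF-*ʳ : ∀ {m} x (f : Vect m) → ΣF f *F x ≡ ΣF (λ i → f i *F x)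
  ΣF-*ʳ x f =
    trans (cong (_*F x) (ΣF≡sum f)) (trans (*-distribʳ-sum x f) (sym (ΣF≡sum (λ i → f i *F x))))

  ΣF-neg : ∀ {m} (f : Vect m) → ΣF (λ i → -F f i) ≡ -F ΣF f
  ΣF-neg f = begin
    ΣF (λ i → -F f i)          ≡⟨ ΣF-cong (λ i → -1*x≈-x (f i)) ⟨
    ΣF (λ i → -F 1F *F f i)    ≡⟨ ΣF-*ˡ (-F 1F) f ⟨
    -F 1F *F ΣF f              ≡⟨ -1*x≈-x (ΣF f) ⟩
    -F ΣF f                    ∎

  ΣF-− : ∀ {m} (f g : Vect m) → ΣF (λ i → f i +F -F g i) ≡ ΣF f +F -F ΣF g
  ΣF-− f g = trans (ΣF-+ f (λ i → -F g i)) (cong (ΣF f +F_) (ΣF-neg g))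

  ΣF-comm : ∀ {m n} (f : Fin m → Fin n → Carrier) →
            ΣF (λ i → ΣF (f i)) ≡ ΣF (λ j → ΣF (λ i → f i j))
  ΣF-comm f = begin
    ΣF (λ i → ΣF (f i))
      ≡⟨ trans (ΣF-cong (ΣF≡sum ∘ f)) (ΣF≡sum (λ i → sum (f i))) ⟩
    sum (λ i → sum (f i))
      ≡⟨ ∑-comm f ⟩
    sum (λ j → sum (λ i → f i j))
      ≡⟨ trans (ΣF-cong (λ j → ΣF≡sum (λ i → f i j))) (ΣF≡sum (λ j → sum (λ i → f i j))) ⟨
    ΣF (λ j → ΣF (λ i → f i j)) ∎

  ΣF-removeAt : ∀ {m} (f : Vect (suc m)) i → ΣF f ≡ f i +F ΣF (removeAt f i)
  ΣF-removeAt f i = begin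
    ΣF f                       ≡⟨ ΣF≡sum f ⟩
    sum f                      ≡⟨ sum-remove f ⟩
    f i +F sum (removeAt f i)  ≡⟨ cong (f i +F_) (ΣF≡sum (removeAt f i)) ⟨
    f i +F ΣF (removeAt f i)   ∎

  ΣF-single : ∀ {m} (f : Vect m) p → (∀ i → i ≢ p → f i ≡ 0F) → ΣF f ≡ f p
  ΣF-single {suc m} f p f≡0 = begin
    ΣF f                       ≡⟨ ΣF-removeAt f p ⟩
    f p +F ΣF (removeAt f p)   ≡⟨ cong (f p +F_) (ΣF-zero (λ i → f≡0 _ (Fin.punchInᵢ≢i p i))) ⟩
    f p +F 0F                  ≡⟨ +-identityʳ (f p) ⟩
    f p                        ∎

  ΣF-↑ : ∀ a {b} (f : Vect (a + b)) → ΣF f ≡ ΣF (f ∘ (_↑ˡ b)) +F ΣF (f ∘ (a ↑ʳ_))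
  ΣF-↑ zero    f = sym (+-identityˡ _)
  ΣF-↑ (suc a) f = trans (cong (f zero +F_) (ΣF-↑ a (f ∘ suc))) (sym (+-assoc _ _ _))

  lincomb-congˡ : ∀ {m n} {c c' : Vect m} (vs : Fin m → Vect n) → c ≗ c' →
                  lincomb c vs ≗ lincomb c' vs
  lincomb-congˡ vs c≗c' j = ΣF-cong (λ i → cong (_*F vs i j) (c≗c' i))

  lincomb-congʳ : ∀ {m n} (c : Vect m) {vs vs' : Fin m → Vect n} → (∀ i → vs i ≗ vs' i) →
                  lincomb c vs ≗ lincomb c vs'
  lincomb-congʳ c vs≗vs' j = ΣF-cong (λ i → cong (c i *F_) (vs≗vs' i j))

  lincomb-zeroˡ : ∀ {m n} {c : Vect m} (vs : Fin m → Vect n) → (∀ i → c i ≡ 0F) →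
                  ∀ j → lincomb c vs j ≡ 0F
  lincomb-zeroˡ vs c≡0 j = ΣF-zero (λ i → trans (cong (_*F vs i j) (c≡0 i)) (zeroˡ _))

  lincomb-zeroʳ : ∀ {m n} (c : Vect m) {vs : Fin m → Vect n} {j} → (∀ i → vs i j ≡ 0F) →
                  lincomb c vs j ≡ 0F
  lincomb-zeroʳ c vs≡0 = ΣF-zero (λ i → trans (cong (c i *F_) (vs≡0 i)) (zeroʳ (c i)))

  lincomb-+ : ∀ {m n} (c c' : Vect m) (vs : Fin m → Vect n) j →
              lincomb (λ i → c i +F c' i) vs j ≡ lincomb c vs j +F lincomb c' vs j
  lincomb-+ c c' vs j = trans (ΣF-cong (λ i → distribʳ (vs i j) (c i) (c' i)))
    (ΣF-+ (λ i → c i *F vs i j) (λ i → c' i *F vs i j))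

  lincomb-−ˡ : ∀ {m n} (c c' : Vect m) (vs : Fin m → Vect n) j →
               lincomb (λ i → c i +F -F c' i) vs j ≡ lincomb c vs j +F -F lincomb c' vs j
  lincomb-−ˡ c c' vs j = trans (ΣF-cong (λ i → [y-z]x≈yx-zx (vs i j) (c i) (c' i)))
    (ΣF-− (λ i → c i *F vs i j) (λ i → c' i *F vs i j))

  lincomb-−ʳ : ∀ {k n} (c : Vect k) (A B : Mat k n) j →
               lincomb c (A -M B) j ≡ lincomb c A j +F -F lincomb c B j
  lincomb-−ʳ c A B j = trans (ΣF-cong (λ i → x[y-z]≈xy-xz (c i) (A i j) (B i j)))
    (ΣF-− (λ i → c i *F A i j) (λ i → c i *F B i j))

  lincomb-assoc : ∀ {a b n} (c : Vect a) (β : Fin a → Vect b) (G : Fin b → Vect n) →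
                  lincomb c (λ l → lincomb (β l) G) ≗ lincomb (lincomb c β) G
  lincomb-assoc c β G j = begin
    ΣF (λ l → c l *F ΣF (λ p → β l p *F G p j))
      ≡⟨ ΣF-cong (λ l → ΣF-*ˡ (c l) (λ p → β l p *F G p j)) ⟩
    ΣF (λ l → ΣF (λ p → c l *F (β l p *F G p j)))
      ≡⟨ ΣF-comm (λ l p → c l *F (β l p *F G p j)) ⟩
    ΣF (λ p → ΣF (λ l → c l *F (β l p *F G p j)))
      ≡⟨ ΣF-cong (λ p → ΣF-cong (λ l → *-assoc (c l) (β l p) (G p j))) ⟨
    ΣF (λ p → ΣF (λ l → (c l *F β l p) *F G p j))
      ≡⟨ ΣF-cong (λ p → ΣF-*ʳ (G p j) (λ l → c l *F β l p)) ⟨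
    ΣF (λ p → ΣF (λ l → c l *F β l p) *F G p j) ∎

  lincomb-insertAt : ∀ {m n} (c : Vect m) i (vs : Fin (suc m) → Vect n) →
                     lincomb (insertAt c i 0F) vs ≗ lincomb c (removeAt vs i)
  lincomb-insertAt c i vs j = begin
    lincomb (insertAt c i 0F) vs j
      ≡⟨ ΣF-removeAt (λ p → insertAt c i 0F p *F vs p j) i ⟩
    insertAt c i 0F i *F vs i j +F ΣF (λ l → insertAt c i 0F (punchIn i l) *F vs (punchIn i l) j)
      ≡⟨ cong₂ _+F_ (trans (cong (_*F vs i j) (insertAt-lookup c i 0F)) (zeroˡ _))
                    (ΣF-cong (λ l → cong (_*F vs (punchIn i l) j) (insertAt-punchIn c i 0F l))) ⟩
    0F +F lincomb c (removeAt vs i) j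
      ≡⟨ +-identityˡ _ ⟩
    lincomb c (removeAt vs i) j ∎

  lincomb-++ : ∀ {c d n} (a : Vect (c + d)) (γ : Fin c → Vect n) (β : Fin d → Vect n) →
               ∀ j → lincomb a (γ ++ β) j ≡ lincomb (a ∘ (_↑ˡ d)) γ j +F lincomb (a ∘ (c ↑ʳ_)) β j
  lincomb-++ {c} {d} a γ β j = trans (ΣF-↑ c _) (cong₂ _+F_
    (ΣF-cong (λ i → cong (λ v → a (i ↑ˡ d) *F v j) (lookup-++ˡ γ β i)))
    (ΣF-cong (λ i → cong (λ v → a (c ↑ʳ i) *F v j) (lookup-++ʳ γ β i))))

  basis : ∀ {m} → Fin m → Vect m
  basis p i with i Fin.≟ p
  ... | yes _ = 1F
  ... | no _  = 0F

  lincomb-basis : ∀ {m n} p (vs : Fin m → Vect n) → lincomb (basis p) vs ≗ vs p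
  lincomb-basis p vs j = trans (ΣF-single _ p basis-off) basis-diag
    where
    basis-off : ∀ i → i ≢ p → basis p i *F vs i j ≡ 0F
    basis-off i i≢p with i Fin.≟ p
    ... | yes i≡p = ⊥-elim (i≢p i≡p)
    ... | no _    = zeroˡ _
    basis-diag : basis p p *F vs p j ≡ vs p j
    basis-diag with p Fin.≟ p
    ... | yes _   = *-identityˡ _
    ... | no p≢p  = ⊥-elim (p≢p refl)

  rows∈rowSpan : ∀ {m n} (A : Mat m n) p → InRowSpan A (A p)
  rows∈rowSpan A p = basis p , sym ∘ lincomb-basis p A

  open Inverse enumeration using ()
    renaming (to to element; from to index; strictlyInverseˡ to element-index)

  _≟F_ : DecidableEquality Carrier
  x ≟F y = map′ index-injective (cong index) (index x Fin.≟ index y)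
    where
    index-injective : index x ≡ index y → x ≡ y
    index-injective eq = trans (sym (element-index x)) (trans (cong element eq) (element-index y))

  any?ᶠ : {P : Carrier → Set} → Decidable P → Dec (∃ P)
  any?ᶠ {P} P? = map′ (λ (i , p) → element i , p)
                      (λ (x , p) → index x , subst P (sym (element-index x)) p)
                      (Fin.any? (P? ∘ element))

  anyVect? : ∀ m {Q : Vect m → Set} → Q Respects _≗_ → Decidable Q → Dec (∃ Q)
  anyVect? zero    Q-resp Q? = map′ ([] ,_) (λ (c , q) → Q-resp {c} (λ ()) q) (Q? [])
  anyVect? (suc m) {Q} Q-resp Q? =
    map′ (λ (a , c , q) → a ∷ c , q)
         (λ (c , q) → head c , tail c , Q-resp (λ { zero → refl ; (suc i) → refl }) q)
         (any?ᶠ (λ a → anyVect? m (λ c≗c' → Q-resp (λ { zero → refl ; (suc i) → c≗c' i }))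
                                  (λ c → Q? (a ∷ c))))

  Kernel : ∀ {m n} → (Fin m → Vect n) → Vect m → Set
  Kernel K c = ∀ j → lincomb c K j ≡ 0F

  Dependence : ∀ {m n} → (Fin m → Vect n) → Vect m → Set
  Dependence K c = Kernel K c × ∃ λ i → c i ≢ 0F

  linIndep⊎dependent : ∀ {m n} (K : Fin m → Vect n) → LinIndep K ⊎ ∃ (Dependence K)
  linIndep⊎dependent {m} K with anyVect? m dependence-resp dependence?
    where
    dependence-resp : Dependence K Respects _≗_
    dependence-resp c≗c' (c∈ker , i , cᵢ≢0) =
      (λ j → trans (sym (lincomb-congˡ K c≗c' j)) (c∈ker j)) , i , cᵢ≢0 ∘ trans (c≗c' i)
    dependence? : Decidable (Dependence K)
    dependence? c = Fin.all? (λ j → lincomb c K j ≟F 0F) ×-dec Fin.any? (λ i → ¬? (c i ≟F 0F))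
  ... | yes dependence = inj₂ dependence
  ... | no ¬dependence = inj₁ λ c c∈ker i →
    decidable-stable (c i ≟F 0F) (λ cᵢ≢0 → ¬dependence (c , c∈ker , i , cᵢ≢0))

  kernel-lincomb : ∀ {m n d} {K : Fin m → Vect n} (β : Vect d) {G : Fin d → Vect m} →
                   (∀ l → Kernel K (G l)) → Kernel K (lincomb β G)
  kernel-lincomb {K = K} β {G} G∈ker j =
    trans (sym (lincomb-assoc β G K j)) (lincomb-zeroʳ β {λ l → lincomb (G l) K} (λ l → G∈ker l j))

  linIndep-tail : ∀ {m n} {vs : Fin (suc m) → Vect n} → LinIndep vs → LinIndep (tail vs)
  linIndep-tail {vs = vs} vs-indep c lc≡0 i = vs-indep (0F ∷ c) (λ j → begin
    0F *F vs zero j +F lincomb c (tail vs) j  ≡⟨ cong (_+F lincomb c (tail vs) j) (zeroˡ _) ⟩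
    0F +F lincomb c (tail vs) j               ≡⟨ +-identityˡ _ ⟩
    lincomb c (tail vs) j                     ≡⟨ lc≡0 j ⟩
    0F                                        ∎) (suc i)

  linIndep-lincomb : ∀ {a b n} {β : Fin a → Vect b} {G : Fin b → Vect n} →
                     LinIndep β → LinIndep G → LinIndep (λ l → lincomb (β l) G)
  linIndep-lincomb {β = β} {G} β-indep G-indep c lc≡0 = β-indep c (G-indep (lincomb c β)
    (λ j → trans (sym (lincomb-assoc c β G j)) (lc≡0 j)))

  linIndep-coefficients : ∀ {m k n} {xs : Fin m → Vect n} (γ : Fin m → Vect k) (A : Mat k n) →
    (∀ l → xs l ≗ lincomb (γ l) A) → LinIndep xs → LinIndep γ
  linIndep-coefficients γ A xs≗ xs-indep c c·γ≡0 = xs-indep c (λ j →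
    trans (lincomb-congʳ c xs≗ j) (trans (lincomb-assoc c γ A j) (lincomb-zeroˡ A c·γ≡0 j)))

  linIndep-injective : ∀ {m n} {vs : Fin m → Vect n} → LinIndep vs → ∀ {c c'} →
                       lincomb c vs ≗ lincomb c' vs → c ≗ c'
  linIndep-injective {vs = vs} vs-indep {c} {c'} lc≗lc' i = x∙y⁻¹≈ε⇒x≈y (c i) (c' i)
    (vs-indep (λ i → c i +F -F c' i)
      (λ j → trans (lincomb-−ˡ c c' vs j) (trans (cong (_+F _) (lc≗lc' j)) (-‿inverseʳ _))) i)

  linIndep-++ : ∀ {c d n} {γ : Fin c → Vect n} {β : Fin d → Vect n} → LinIndep γ →
    (∀ a b → (∀ j → lincomb a γ j +F lincomb b β j ≡ 0F) → ∀ i → b i ≡ 0F) →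
    LinIndep (γ ++ β)
  linIndep-++ {c} {d} {γ = γ} {β} γ-indep β-separated a lc≡0 = ∀-↑ {P = λ i → a i ≡ 0F} a₁≡0 a₂≡0
    where
    a₁ = a ∘ (_↑ˡ d)
    a₂ = a ∘ (c ↑ʳ_)
    split≡0 : ∀ j → lincomb a₁ γ j +F lincomb a₂ β j ≡ 0F
    split≡0 j = trans (sym (lincomb-++ a γ β j)) (lc≡0 j)
    a₂≡0 = β-separated a₁ a₂ split≡0
    a₁≡0 = γ-indep a₁ (λ j → trans (sym (+-identityʳ _))
      (trans (cong (lincomb a₁ γ j +F_) (sym (lincomb-zeroˡ β a₂≡0 j))) (split≡0 j)))

  dim-⊆ : ∀ {n} {U U' : Vect n → Set} {m} → U ⊆ U' → DimAtLeast U m → DimAtLeast U' m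
  dim-⊆ U⊆U' (vs , vs-indep , vs∈U) = vs , vs-indep , U⊆U' ∘ vs∈U

  dim-zero : ∀ {n} (U : Vect n → Set) → DimAtLeast U 0
  dim-zero _ = (λ ()) , (λ _ _ ()) , (λ ())

  dim-≤ : ∀ {n} (U : Vect n → Set) {m m'} → m' ≤ m → DimAtLeast U m → DimAtLeast U m'
  dim-≤ U {m' = m'} m'≤m = go (ℕ.≤⇒≤′ m'≤m)
    where
    go : ∀ {m} → m' ≤′ m → DimAtLeast U m → DimAtLeast U m'
    go ≤′-refl          dim                   = dim
    go (≤′-step m'≤′m) (vs , vs-indep , vs∈U) =
      go m'≤′m (tail vs , linIndep-tail {vs = vs} vs-indep , vs∈U ∘ suc)

  removeAt-rowSpan : ∀ {m n} (K : Fin (suc m) → Vect n) i → InRowSpan (removeAt K i) ⊆ InRowSpan K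
  removeAt-rowSpan K i (c , x≡) =
    insertAt c i 0F , λ j → trans (x≡ j) (sym (lincomb-insertAt c i K j))

  kernel-extend : ∀ {m n d} (K : Fin (suc m) → Vect n) {c : Vect (suc m)} {i} →
                  Kernel K c → c i ≢ 0F →
                  DimAtLeast (Kernel (removeAt K i)) d → DimAtLeast (Kernel K) (suc d)
  kernel-extend {d = d} K {c} {i} c∈ker cᵢ≢0 (γ , γ-indep , γ∈ker) = Φ , Φ-indep , Φ∈ker
    where
    Φ : Fin (suc d) → Vect _
    Φ = c ∷ (λ l → insertAt (γ l) i 0F)
    Φ∈ker : ∀ l → Kernel K (Φ l)
    Φ∈ker zero    = c∈ker
    Φ∈ker (suc l) j = trans (lincomb-insertAt (γ l) i K j) (γ∈ker l j)
    Φ-indep : LinIndep Φ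
    Φ-indep a lc≡0 = λ { zero → a₀≡0 ; (suc l) → tail-a≡0 l }
      where
      rest = lincomb (tail a) (tail Φ)
      a₀≡0 : a zero ≡ 0F
      a₀≡0 = x*y≡0⇒y≡0 cᵢ≢0 (begin
        c i *F a zero              ≡⟨ *-comm (c i) (a zero) ⟩
        a zero *F c i              ≡⟨ +-identityʳ _ ⟨
        a zero *F c i +F 0F        ≡⟨ cong (a zero *F c i +F_)
                                         (lincomb-zeroʳ (tail a) {tail Φ} (λ l → insertAt-lookup (γ l) i 0F)) ⟨
        a zero *F c i +F rest i    ≡⟨ lc≡0 i ⟩
        0F                         ∎)
      tail-a≡0 : ∀ l → a (suc l) ≡ 0F
      tail-a≡0 = γ-indep (tail a) λ j → begin
        lincomb (tail a) γ j                            ≡⟨ lincomb-congʳ (tail a)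
                                                             (λ l j → sym (insertAt-punchIn (γ l) i 0F j)) j ⟩
        rest (punchIn i j)                              ≡⟨ +-identityˡ _ ⟨
        0F +F rest (punchIn i j)                        ≡⟨ cong (_+F rest (punchIn i j))
                                                             (trans (cong (_*F c (punchIn i j)) a₀≡0) (zeroˡ _)) ⟨
        a zero *F c (punchIn i j) +F rest (punchIn i j) ≡⟨ lc≡0 (punchIn i j) ⟩
        0F                                              ∎

  -- Drop a row occurring in a dependency (if there is none, the rows are independent and there
  -- are at most u of them), and extend a basis of the kernel of the rest by that dependency.
  kernel-dim : ∀ {m n} (K : Fin m → Vect n) u → RankAtMost K u → DimAtLeast (Kernel K) (m ∸ u)
  kernel-dim {zero} K u _ = subst (DimAtLeast (Kernel K)) (sym (ℕ.0∸n≡0 u)) (dim-zero (Kernel K))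
  kernel-dim {suc m} K u rank≤u with linIndep⊎dependent K
  ... | inj₁ K-indep = subst (DimAtLeast (Kernel K)) (sym (ℕ.m≤n⇒m∸n≡0 m<u)) (dim-zero (Kernel K))
    where
    m<u : suc m ≤ u
    m<u = ℕ.≮⇒≥ (λ u<m → rank≤u (dim-≤ (InRowSpan K) u<m (K , K-indep , rows∈rowSpan K)))
  ... | inj₂ (c , c∈ker , i , cᵢ≢0) =
    dim-≤ (Kernel K) (suc-∸-≤ m u) (kernel-extend K {c} {i} c∈ker cᵢ≢0 (kernel-dim (removeAt K i) u
      (rank≤u ∘ dim-⊆ {U = InRowSpan (removeAt K i)} (removeAt-rowSpan K i))))

  -- (v , -u) is a dependency between u and v; if it is trivial then v = 0 and (0 , 1) is one.
  F¹-dependent : (vs : Fin 2 → Vect 1) → ¬ LinIndep vs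
  F¹-dependent vs vs-indep = 1≢0 (vs-indep (0F ∷ 1F ∷ []) (λ { zero → second }) (suc zero))
    where
    u = vs zero zero
    v = vs (suc zero) zero
    v≡0 : v ≡ 0F
    v≡0 = vs-indep (v ∷ -F u ∷ []) (λ { zero → begin
        v *F u +F (-F u *F v +F 0F)  ≡⟨ cong (v *F u +F_) (+-identityʳ _) ⟩
        v *F u +F -F u *F v          ≡⟨ cong (v *F u +F_) (-‿distribˡ-* u v) ⟨
        v *F u +F -F (u *F v)        ≡⟨ cong (λ w → v *F u +F -F w) (*-comm u v) ⟩
        v *F u +F -F (v *F u)        ≡⟨ -‿inverseʳ _ ⟩
        0F                           ∎ }) zero
    second : 0F *F u +F (1F *F v +F 0F) ≡ 0F
    second = begin
      0F *F u +F (1F *F v +F 0F)  ≡⟨ cong₂ _+F_ (zeroˡ u) (+-identityʳ _) ⟩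
      0F +F 1F *F v               ≡⟨ +-identityˡ _ ⟩
      1F *F v                     ≡⟨ *-identityˡ v ⟩
      v                           ≡⟨ v≡0 ⟩
      0F                          ∎

  -- The kernel of the first column gives m - 1 independent combinations of the vs with first
  -- coordinate 0; their tails are independent in F^(n-1).
  linIndep⇒≤ : ∀ {m n} (vs : Fin m → Vect n) → LinIndep vs → m ≤ n
  linIndep⇒≤ {zero}          _  _        = z≤n
  linIndep⇒≤ {suc m} {zero}  vs vs-indep = ⊥-elim (1≢0 (vs-indep (const 1F) (λ ()) zero))
  linIndep⇒≤ {suc m} {suc n} vs vs-indep
    with kernel-dim (λ l _ → head (vs l)) 1 (λ (ws , ws-indep , _) → F¹-dependent ws ws-indep)
  ... | γ , γ-indep , γ∈ker = s≤s (linIndep⇒≤ (λ l → tail (lincomb (γ l) vs)) tails-indep)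
    where
    tails-indep : LinIndep (λ l → tail (lincomb (γ l) vs))
    tails-indep c lc≡0 = linIndep-lincomb {β = γ} {vs} γ-indep vs-indep c λ
      { zero    → lincomb-zeroʳ c {λ l → lincomb (γ l) vs} (λ l → γ∈ker l zero)
      ; (suc j) → lc≡0 j }

  linIndep-rowSpan⇒≤ : ∀ {m a n} {vs : Fin m → Vect n} (A : Mat a n) →
                       LinIndep vs → (∀ l → InRowSpan A (vs l)) → m ≤ a
  linIndep-rowSpan⇒≤ A vs-indep vs∈span =
    linIndep⇒≤ _ (linIndep-coefficients (proj₁ ∘ vs∈span) A (proj₂ ∘ vs∈span) vs-indep)

  rank≤columns : ∀ {m n} (K : Mat m n) → RankAtMost K n
  rank≤columns K (vs , vs-indep , _) = ℕ.<-irrefl refl (linIndep⇒≤ vs vs-indep)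

  rowSpan-hasDim : ∀ {k n} {X : Mat k n} → LinIndep X → HasDim (InRowSpan X) k
  rowSpan-hasDim {X = X} X-indep = (X , X-indep , rows∈rowSpan X) ,
    λ (vs , vs-indep , vs∈span) → ℕ.<-irrefl refl (linIndep-rowSpan⇒≤ X vs-indep vs∈span)

  rowSpan-hasDim⇒≥ : ∀ {k n a} {X : Mat k n} → LinIndep X → HasDim (InRowSpan X) a → k ≤ a
  rowSpan-hasDim⇒≥ {X = X} X-indep (_ , ¬dim>a) =
    ℕ.≮⇒≥ (λ a<k → ¬dim>a (dim-≤ (InRowSpan X) a<k (X , X-indep , rows∈rowSpan X)))

  -- DimAtLeast U is not decidable for an arbitrary U, so an exact dimension only exists under ¬ ¬.
  hasDim-above : ∀ {n m} (U : Vect n → Set) → DimAtLeast U m → ¬ ¬ ∃ λ d → m ≤ d × HasDim U d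
  hasDim-above {n} {m} U dim = go n (ℕ.m≤n+m n m) dim ℕ.≤-refl
    where
    go : ∀ gap {d} → n ≤ d + gap → DimAtLeast U d → m ≤ d → ¬ ¬ ∃ λ d → m ≤ d × HasDim U d
    go zero {d} n≤d dim m≤d ¬hasDim = ¬hasDim (d , m≤d , dim , λ (vs , vs-indep , _) →
      ℕ.<⇒≱ (linIndep⇒≤ vs vs-indep) (subst (n ≤_) (ℕ.+-identityʳ d) n≤d))
    go (suc gap) {d} n≤d dim m≤d ¬hasDim = ¬¬-excluded-middle λ
      { (yes dim') → go gap (subst (n ≤_) (ℕ.+-suc d gap) n≤d) dim' (ℕ.m≤n⇒m≤1+n m≤d) ¬hasDim
      ; (no ¬dim') → ¬hasDim (d , m≤d , dim , ¬dim') }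

  kernel+rank≤rows : ∀ {k n c d} (D : Mat k n) →
                     DimAtLeast (Kernel D) c → RankAtLeast D d → c + d ≤ k
  kernel+rank≤rows D (γ , γ-indep , γ∈ker) (ys , ys-indep , ys∈span) =
    linIndep⇒≤ (γ ++ β) (linIndep-++ γ-indep β-separated)
    where
    β = proj₁ ∘ ys∈span
    β-separated : ∀ a b → (∀ j → lincomb a γ j +F lincomb b β j ≡ 0F) → ∀ i → b i ≡ 0F
    β-separated a b sum≡0 = ys-indep b λ j → begin
      lincomb b ys j                                          ≡⟨ lincomb-congʳ b (proj₂ ∘ ys∈span) j ⟩
      lincomb b (λ l → lincomb (β l) D) j                     ≡⟨ lincomb-assoc b β D j ⟩
      lincomb (lincomb b β) D j                               ≡⟨ +-identityˡ _ ⟨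
      0F +F lincomb (lincomb b β) D j
        ≡⟨ cong (_+F _) (kernel-lincomb {K = D} a {γ} γ∈ker j) ⟨
      lincomb (lincomb a γ) D j +F lincomb (lincomb b β) D j  ≡⟨ lincomb-+ (lincomb a γ) (lincomb b β) D j ⟨
      lincomb (λ p → lincomb a γ p +F lincomb b β p) D j      ≡⟨ lincomb-zeroˡ D sum≡0 j ⟩
      0F                                                      ∎

  ∣-↑ˡ : ∀ {k a b} (A : Mat k a) (B : Mat k b) i j → (A ∣ B) i (j ↑ˡ b) ≡ A i j
  ∣-↑ˡ {a = a} {b} A B i j with splitAt a (j ↑ˡ b) | Fin.splitAt-↑ˡ a j b
  ... | inj₁ .j | refl = refl

  ∣-↑ʳ : ∀ {k a b} (A : Mat k a) (B : Mat k b) i j → (A ∣ B) i (a ↑ʳ j) ≡ B i j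
  ∣-↑ʳ {a = a} {b} A B i j with splitAt a (a ↑ʳ j) | Fin.splitAt-↑ʳ a b j
  ... | inj₂ .j | refl = refl

  lincomb-∣ˡ : ∀ {k a b} (c : Vect k) (A : Mat k a) (B : Mat k b) j →
               lincomb c (A ∣ B) (j ↑ˡ b) ≡ lincomb c A j
  lincomb-∣ˡ c A B j = lincomb-congʳ c (λ i _ → ∣-↑ˡ A B i j) j

  lincomb-∣ʳ : ∀ {k a b} (c : Vect k) (A : Mat k a) (B : Mat k b) j →
               lincomb c (A ∣ B) (a ↑ʳ j) ≡ lincomb c B j
  lincomb-∣ʳ c A B j = lincomb-congʳ c (λ i _ → ∣-↑ʳ A B i j) j

  linIndep-∣ʳ : ∀ {k a b} (A : Mat k a) {B : Mat k b} → LinIndep B → LinIndep (A ∣ B)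
  linIndep-∣ʳ {a = a} A {B} B-indep c lc≡0 =
    B-indep c (λ j → trans (sym (lincomb-∣ʳ c A B j)) (lc≡0 (a ↑ʳ j)))

  zeroId-↑ˡ : ∀ r s p j → ZeroId r s p (j ↑ˡ s) ≡ 0F
  zeroId-↑ˡ r s p j with splitAt r (j ↑ˡ s) | Fin.splitAt-↑ˡ r j s
  ... | inj₁ .j | refl = refl

  zeroId-↑ʳ-diag : ∀ r s p → ZeroId r s p (r ↑ʳ p) ≡ 1F
  zeroId-↑ʳ-diag r s p with splitAt r (r ↑ʳ p) | Fin.splitAt-↑ʳ r s p
  ... | inj₂ .p | refl with p Fin.≟ p
  ...   | yes _   = refl
  ...   | no p≢p  = ⊥-elim (p≢p refl)

  zeroId-↑ʳ-off : ∀ r s p i → p ≢ i → ZeroId r s p (r ↑ʳ i) ≡ 0F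
  zeroId-↑ʳ-off r s p i p≢i with splitAt r (r ↑ʳ i) | Fin.splitAt-↑ʳ r s i
  ... | inj₂ .i | refl with p Fin.≟ i
  ...   | yes p≡i = ⊥-elim (p≢i p≡i)
  ...   | no _    = refl

  lincomb-zeroId : ∀ r s (c : Vect s) i → lincomb c (ZeroId r s) (r ↑ʳ i) ≡ c i
  lincomb-zeroId r s c i = begin
    lincomb c (ZeroId r s) (r ↑ʳ i)
      ≡⟨ ΣF-single _ i (λ p p≢i → trans (cong (c p *F_) (zeroId-↑ʳ-off r s p i p≢i)) (zeroʳ _)) ⟩
    c i *F ZeroId r s i (r ↑ʳ i)     ≡⟨ cong (c i *F_) (zeroId-↑ʳ-diag r s i) ⟩
    c i *F 1F                        ≡⟨ *-comm (c i) 1F ⟩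
    1F *F c i                        ≡⟨ *-identityˡ (c i) ⟩
    c i                              ∎

  zeroId-linIndep : ∀ r s → LinIndep (ZeroId r s)
  zeroId-linIndep r s c lc≡0 i = trans (sym (lincomb-zeroId r s c i)) (lc≡0 (r ↑ʳ i))

  -- Not tied to r + s columns, so that it survives the castMat along colEq.
  VanishesOnFirst : ∀ {n} → ℕ → Vect n → Set
  VanishesOnFirst r x = ∀ j → toℕ j < r → x j ≡ 0F

  vanishing⊆rowSpan-zeroId : ∀ r s → VanishesOnFirst r ⊆ InRowSpan (ZeroId r s)
  vanishing⊆rowSpan-zeroId r s {x} x-vanishes = x ∘ (r ↑ʳ_) , ∀-↑ left right
    where
    left : ∀ j → x (j ↑ˡ s) ≡ lincomb (x ∘ (r ↑ʳ_)) (ZeroId r s) (j ↑ˡ s)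
    left j = trans (x-vanishes (j ↑ˡ s) (subst (_< r) (sym (Fin.toℕ-↑ˡ j s)) (Fin.toℕ<n j)))
                   (sym (lincomb-zeroʳ _ {ZeroId r s} (λ p → zeroId-↑ˡ r s p j)))
    right : ∀ i → x (r ↑ʳ i) ≡ lincomb (x ∘ (r ↑ʳ_)) (ZeroId r s) (r ↑ʳ i)
    right i = sym (lincomb-zeroId r s (x ∘ (r ↑ʳ_)) i)

  dim-vanishing-castMat : ∀ {k a b m} r (e : a ≡ b) (X : Mat k a) →
    DimAtLeast (VanishesOnFirst r ∩ InRowSpan X) m →
    DimAtLeast (VanishesOnFirst r ∩ InRowSpan (castMat e X)) m
  dim-vanishing-castMat r refl X dim = dim

  rref⇒linIndep : ∀ {k n} {T : Mat k n} → IsRREF T → LinIndep T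
  rref⇒linIndep {T = T} (piv , _ , pivot≡1 , _ , pivot-column≡0) c lc≡0 p = begin
    c p                   ≡⟨ *-identityˡ (c p) ⟨
    1F *F c p             ≡⟨ *-comm 1F (c p) ⟩
    c p *F 1F             ≡⟨ cong (c p *F_) (pivot≡1 p) ⟨
    c p *F T p (piv p)
      ≡⟨ ΣF-single _ p (λ i i≢p → trans (cong (c i *F_) (pivot-column≡0 p i i≢p)) (zeroʳ _)) ⟨
    lincomb c T (piv p)   ≡⟨ lc≡0 (piv p) ⟩
    0F                    ∎

  kernel⇒dim-vanishing-∣ : ∀ {k a b} t m (R : Mat k a) (T : Mat k b) → t ≤ b → LinIndep T →
    DimAtLeast (Kernel R) (m + t) → DimAtLeast (VanishesOnFirst (a + t) ∩ InRowSpan (R ∣ T)) m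
  kernel⇒dim-vanishing-∣ {k} {a} {b} t m R T t≤b T-indep (G , G-indep , G∈ker) =
    combine (subst (DimAtLeast (Kernel N)) (ℕ.m+n∸n≡m m t) (kernel-dim N t (rank≤columns N)))
    where
    N : Fin (m + t) → Vect t
    N l j = lincomb (G l) T (Fin.inject≤ j t≤b)
    combine : DimAtLeast (Kernel N) m → DimAtLeast (VanishesOnFirst (a + t) ∩ InRowSpan (R ∣ T)) m
    combine (β , β-indep , β∈ker) = xs , xs-indep , λ l → xs-vanish l , (γ l , λ _ → refl)
      where
      γ : Fin m → Vect k
      γ l = lincomb (β l) G
      xs : Fin m → Vect (a + b)
      xs l = lincomb (γ l) (R ∣ T)
      xs-indep =
        linIndep-lincomb {β = γ} (linIndep-lincomb {β = β} β-indep G-indep) (linIndep-∣ʳ R T-indep)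
      xs-vanish : ∀ l → VanishesOnFirst (a + t) (xs l)
      xs-vanish l =
        ∀-↑ (λ j _ → trans (lincomb-∣ˡ (γ l) R T j) (kernel-lincomb {K = R} (β l) {G} G∈ker j))
            (λ j j<a+t → trans (lincomb-∣ʳ (γ l) R T j) (right j (j<t j j<a+t)))
        where
        j<t : ∀ j → toℕ (a ↑ʳ j) < a + t → toℕ j < t
        j<t j lt = ℕ.+-cancelˡ-< a (toℕ j) t (subst (_< a + t) (Fin.toℕ-↑ʳ a j) lt)
        right : ∀ j → toℕ j < t → lincomb (γ l) T j ≡ 0F
        right j j<t = begin
          lincomb (γ l) T j                          ≡⟨ cong (lincomb (γ l) T) j≡ ⟨
          lincomb (γ l) T (Fin.inject≤ j' t≤b)       ≡⟨ lincomb-assoc (β l) G T _ ⟨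
          lincomb (β l) N j'                         ≡⟨ β∈ker l j' ⟩
          0F                                         ∎
          where
          j' = Fin.fromℕ< j<t
          j≡ : Fin.inject≤ j' t≤b ≡ j
          j≡ = Fin.toℕ-injective (trans (Fin.toℕ-inject≤ j' t≤b) (Fin.toℕ-fromℕ< j<t))

  dim-vanishing-∣ : ∀ {k a b u} t m (R : Mat k a) (T : Mat k b) → t ≤ b →
                    RankAtMost R u → LinIndep T → m + t + u ≤ k →
                    DimAtLeast (VanishesOnFirst (a + t) ∩ InRowSpan (R ∣ T)) m
  dim-vanishing-∣ {u = u} t m R T t≤b rank≤u T-indep m+t+u≤k =
    kernel⇒dim-vanishing-∣ t m R T t≤b T-indep
      (dim-≤ (Kernel R) (ℕ.m+n≤o⇒m≤o∸n (m + t) m+t+u≤k) (kernel-dim R u rank≤u))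

  dim-zeroId-∩-lift : ∀ δ k r s t {R : Mat k (r ∸ t)} {T : Mat k (s + t)} →
    δ ≤ k → t ≤ k ∸ δ → (t≤r : t ≤ r) → RankAtMost R (k ∸ δ ∸ t) → LinIndep T →
    DimAtLeast (InRowSpan (ZeroId r s) ∩ InRowSpan (castMat (colEq r s t t≤r) (R ∣ T))) δ
  dim-zeroId-∩-lift δ k r s t {R} {T} δ≤k t≤k∸δ t≤r rank≤k∸δ∸t T-indep =
    dim-⊆ {U = VanishesOnFirst r ∩ InRowSpan (castMat (colEq r s t t≤r) (R ∣ T))}
      (map₁ (vanishing⊆rowSpan-zeroId r s))
      (dim-vanishing-castMat r (colEq r s t t≤r) (R ∣ T)
        (subst (λ n → DimAtLeast (VanishesOnFirst n ∩ InRowSpan (R ∣ T)) δ) (ℕ.m∸n+n≡m t≤r)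
          (dim-vanishing-∣ t δ R T (ℕ.m≤n+m t s) rank≤k∸δ∸t T-indep
            (ℕ.≤-reflexive (m+n+[o∸m∸n]≡o δ≤k t≤k∸δ)))))

  ∩-coefficients : ∀ {k k' n m} (A : Mat k n) (A' : Mat k' n) →
    DimAtLeast (InRowSpan A ∩ InRowSpan A') m →
    Σ (Fin m → Vect k) λ γ → Σ (Fin m → Vect k') λ γ' →
      LinIndep γ × (∀ l → lincomb (γ l) A ≗ lincomb (γ' l) A')
  ∩-coefficients A A' (xs , xs-indep , xs∈) =
    γ , γ' , linIndep-coefficients γ A (proj₂ ∘ proj₁ ∘ xs∈) xs-indep ,
    λ l j → trans (sym (proj₂ (proj₁ (xs∈ l)) j)) (proj₂ (proj₂ (xs∈ l)) j)
    where
    γ = proj₁ ∘ proj₁ ∘ xs∈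
    γ' = proj₁ ∘ proj₂ ∘ xs∈

  ∩-∣-project : ∀ {k a b m} (R R' : Mat k a) {B B' : Mat k b} → LinIndep B →
    DimAtLeast (InRowSpan (R ∣ B) ∩ InRowSpan (R' ∣ B')) m → DimAtLeast (InRowSpan B ∩ InRowSpan B') m
  ∩-∣-project {a = a} R R' {B} {B'} B-indep dim with ∩-coefficients (R ∣ B) (R' ∣ B') dim
  ... | γ , γ' , γ-indep , γA≗γ'A' =
    (λ l → lincomb (γ l) B) , linIndep-lincomb {β = γ} γ-indep B-indep ,
    λ l → (γ l , λ _ → refl) , (γ' l , λ j → begin
      lincomb (γ l) B j              ≡⟨ lincomb-∣ʳ (γ l) R B j ⟨
      lincomb (γ l) (R ∣ B) (a ↑ʳ j)   ≡⟨ γA≗γ'A' l (a ↑ʳ j) ⟩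
      lincomb (γ' l) (R' ∣ B') (a ↑ʳ j) ≡⟨ lincomb-∣ʳ (γ' l) R' B' j ⟩
      lincomb (γ' l) B' j            ∎)

  ∩-∣-kernel : ∀ {k a b m} (R R' : Mat k a) {B : Mat k b} → LinIndep B →
    DimAtLeast (InRowSpan (R ∣ B) ∩ InRowSpan (R' ∣ B)) m → DimAtLeast (Kernel (R -M R')) m
  ∩-∣-kernel {a = a} {b} R R' {B} B-indep dim with ∩-coefficients (R ∣ B) (R' ∣ B) dim
  ... | γ , γ' , γ-indep , γA≗γ'A' = γ , γ-indep , λ l j → begin
      lincomb (γ l) (R -M R') j                    ≡⟨ lincomb-−ʳ (γ l) R R' j ⟩
      lincomb (γ l) R j +F -F lincomb (γ l) R' j   ≡⟨ cong (_+F -F lincomb (γ l) R' j) (same-left l j) ⟩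
      lincomb (γ l) R' j +F -F lincomb (γ l) R' j  ≡⟨ -‿inverseʳ _ ⟩
      0F                                           ∎
    where
    γ≗γ' : ∀ l → γ l ≗ γ' l
    γ≗γ' l = linIndep-injective B-indep λ j →
      trans (sym (lincomb-∣ʳ (γ l) R B j)) (trans (γA≗γ'A' l (a ↑ʳ j)) (lincomb-∣ʳ (γ' l) R' B j))
    same-left : ∀ l j → lincomb (γ l) R j ≡ lincomb (γ l) R' j
    same-left l j = begin
      lincomb (γ l) R j               ≡⟨ lincomb-∣ˡ (γ l) R B j ⟨
      lincomb (γ l) (R ∣ B) (j ↑ˡ b)   ≡⟨ γA≗γ'A' l (j ↑ˡ b) ⟩
      lincomb (γ' l) (R' ∣ B) (j ↑ˡ b) ≡⟨ lincomb-∣ˡ (γ' l) R' B j ⟩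
      lincomb (γ' l) R' j             ≡⟨ lincomb-congˡ R' (γ≗γ' l) j ⟨
      lincomb (γ l) R' j              ∎

  subspaceDist⇒∩-bound : ∀ {k n δ m} {B B' : Mat k n} → LinIndep B → LinIndep B' →
    SubspaceDistAtLeast (InRowSpan B) (InRowSpan B') (2 * δ) →
    DimAtLeast (InRowSpan B ∩ InRowSpan B') m → m + δ ≤ k
  subspaceDist⇒∩-bound {δ = δ} {B = B} {B'} B-indep B'-indep dist dim =
    decidable-stable (_ ℕ.≤? _) λ m+δ≰k → hasDim-above (InRowSpan B ∩ InRowSpan B') dim λ (d , m≤d , hasDim) →
      m+δ≰k (ℕ.≤-trans (ℕ.+-monoˡ-≤ _ m≤d)
        (halve-≤ {d} {δ} (dist _ _ d (rowSpan-hasDim B-indep) (rowSpan-hasDim B'-indep) hasDim)))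

  ∩-bound⇒subspaceDist : ∀ {k n δ} {X X' : Mat k n} → LinIndep X → LinIndep X' →
    (∀ {m} → DimAtLeast (InRowSpan X ∩ InRowSpan X') m → m + δ ≤ k) →
    SubspaceDistAtLeast (InRowSpan X) (InRowSpan X') (2 * δ)
  ∩-bound⇒subspaceDist {δ = δ} X-indep X'-indep bound _ _ c hasDimX hasDimX' (dim∩ , _) = ℕ.≤-trans
    (double-≤ {c} {δ} (bound dim∩))
    (ℕ.+-mono-≤ (rowSpan-hasDim⇒≥ X-indep hasDimX) (rowSpan-hasDim⇒≥ X'-indep hasDimX'))

  ∣-∩-bound : ∀ {k a b NB NR δ m} {𝓑 : Fin NB → Mat k b} {𝓡 : Fin NR → Mat k a} →
    IsCDC b NB (2 * δ) k 𝓑 → (∀ i i' → i ≢ i' → RankAtLeast (𝓡 i -M 𝓡 i') δ) →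
    ∀ {j i j' i'} → (j , i) ≢ (j' , i') →
    DimAtLeast (InRowSpan (𝓡 i ∣ 𝓑 j) ∩ InRowSpan (𝓡 i' ∣ 𝓑 j')) m → m + δ ≤ k
  ∣-∩-bound {𝓑 = 𝓑} {𝓡} (𝓑-indep , _ , 𝓑-dist) 𝓡-dist {j} {i} {j'} {i'} ji≢j'i' dim
    with j Fin.≟ j'
  ... | no j≢j'  = subspaceDist⇒∩-bound (𝓑-indep j) (𝓑-indep j') (𝓑-dist j j' j≢j')
                     (∩-∣-project (𝓡 i) (𝓡 i') (𝓑-indep j) dim)
  ... | yes refl = kernel+rank≤rows (𝓡 i -M 𝓡 i') (∩-∣-kernel (𝓡 i) (𝓡 i') (𝓑-indep j) dim)
                     (𝓡-dist i i' (ji≢j'i' ∘ cong (j ,_)))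

  product : ∀ {k a b NB NR} → (Fin NB → Mat k b) → (Fin NR → Mat k a) →
            Fin (NB * NR) → Mat k (a + b)
  product {NB = NB} {NR} 𝓑 𝓡 c =
    𝓡 (proj₂ (Fin.remQuot {NB} NR c)) ∣ 𝓑 (proj₁ (Fin.remQuot {NB} NR c))

  product-isCDC : ∀ {k a b NB NR δ} {𝓑 : Fin NB → Mat k b} {𝓡 : Fin NR → Mat k a} →
    IsCDC b NB (2 * δ) k 𝓑 → (∀ i i' → i ≢ i' → RankAtLeast (𝓡 i -M 𝓡 i') δ) → 0 < δ →
    IsCDC (a + b) (NB * NR) (2 * δ) k (product 𝓑 𝓡)
  product-isCDC {k} {NB = NB} {NR} {δ} {𝓑} {𝓡} 𝓑-cdc 𝓡-dist 0<δ = X-indep , X-distinct , X-dist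
    where
    X = product 𝓑 𝓡
    X-indep : ∀ c → LinIndep (X c)
    X-indep c = linIndep-∣ʳ _ (proj₁ 𝓑-cdc _)
    remQuot-injective : ∀ {c c'} → Fin.remQuot {NB} NR c ≡ Fin.remQuot NR c' → c ≡ c'
    remQuot-injective {c} {c'} eq = trans (sym (Fin.combine-remQuot {NB} NR c))
      (trans (cong (uncurry Fin.combine) eq) (Fin.combine-remQuot {NB} NR c'))
    bound : ∀ {c c' m} → c ≢ c' → DimAtLeast (InRowSpan (X c) ∩ InRowSpan (X c')) m → m + δ ≤ k
    bound c≢c' = ∣-∩-bound 𝓑-cdc 𝓡-dist (c≢c' ∘ remQuot-injective)
    X-dist : ∀ c c' → c ≢ c' → SubspaceDistAtLeast (InRowSpan (X c)) (InRowSpan (X c')) (2 * δ)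
    X-dist c c' c≢c' = ∩-bound⇒subspaceDist {δ = δ} (X-indep c) (X-indep c') (bound c≢c')
    X-distinct : ∀ c c' → c ≢ c' → ¬ SameRowSpan (X c) (X c')
    X-distinct c c' c≢c' same = ℕ.<⇒≱ (ℕ.m<m+n k 0<δ)
      (bound c≢c' (X c , X-indep c , λ l → rows∈rowSpan (X c) l , proj₁ (same _) (rows∈rowSpan (X c) l)))

  castMat-isCDC : ∀ {a b N d k} (e : a ≡ b) {X : Fin N → Mat k a} → IsCDC a N d k X →
                  IsCDC b N d k (castMat e ∘ X)
  castMat-isCDC refl cdc = cdc

lemma11 : ∀ {q : ℕ} (F : FiniteField q) → let open LinAlg F in
    (δ k r s t : ℕ) → 2 ≤ δ → δ ≤ k → k ≤ s + t →
    t ≤ k ∸ δ → (t≤r : t ≤ r) →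
    (NB : ℕ) (𝓑 : Fin NB → Mat k (s + t)) → IsCDC (s + t) NB (2 * δ) k 𝓑 →
    (NR : ℕ) (𝓡 : Fin NR → Mat k (r ∸ t)) → IsRMC k (r ∸ t) NR δ (k ∸ δ ∸ t) 𝓡 →
      ((i : Fin NR) (j : Fin NB) (T : Mat k (s + t)) → IsRREF T → SameRowSpan T (𝓑 j) →
        DimAtLeast (InRowSpan (ZeroId r s) ∩ InRowSpan (castMat (colEq r s t t≤r) (𝓡 i ∣ T))) δ)
    × Σ (Fin (NB * NR) → Mat k (r + s)) (λ 𝓒 →
        IsCDC (r + s) (NB * NR) (2 * δ) k 𝓒
        × Σ (Mat s (r + s)) (λ W → FullRowRank W
            × ((c : Fin (NB * NR)) → DimAtLeast (InRowSpan W ∩ InRowSpan (𝓒 c)) δ)))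
lemma11 F δ k r s t 2≤δ δ≤k _ t≤k∸δ t≤r NB 𝓑 𝓑-cdc NR 𝓡 (_ , 𝓡-dist , 𝓡-rank) =
    (λ i _ T T-rref _ → dim-zeroId-∩-lift δ k r s t δ≤k t≤k∸δ t≤r (𝓡-rank i) (rref⇒linIndep T-rref))
  , castMat e ∘ product 𝓑 𝓡
  , castMat-isCDC {d = 2 * δ} e (product-isCDC {δ = δ} 𝓑-cdc 𝓡-dist (ℕ.<-≤-trans (s≤s z≤n) 2≤δ))
  , ZeroId r s
  , zeroId-linIndep r s
  , λ c → dim-zeroId-∩-lift δ k r s t δ≤k t≤k∸δ t≤r (𝓡-rank (proj₂ (Fin.remQuot {NB} NR c)))
                                                      (proj₁ 𝓑-cdc (proj₁ (Fin.remQuot {NB} NR c)))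
  where
  open LinAlg F using (castMat; ZeroId)
  open FiniteFieldLinearAlgebra F
  e = colEq r s t t≤r
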